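{- Let $G$ be a strongly connected digraph. Then the second univariate distance ideal satisfies $U_2(G)\neq\langle 1\rangle$ if and only if $G$ is isomorphic to $\overrightarrow{C_3}$ or to a strongly connected digraph $\Lambda(a,b,c,d)$ where either $a\neq 0$ and $b=c=d=0$, or $c\neq0$ and $a=b=d=0$, or $b,d\geq 1$ and $a=c=0$.
   Context: A digraph is simple: no loops and no multiple arcs. It is strongly connected if for all vertices $u,v$ there is a directed $uv$-walk; $\operatorname{dist}(u,v)$ is the number of arcs of a shortest directed $uv$-walk and $D(G)$ is the distance matrix. For $G$ with $n$ vertices, the $i$-th univariate distance ideal $U_i(G)$ is the ideal of $\mathbb{Z}[t]$ generated by all $i\times i$ minors of $tI_n+D(G)$. $\overrightarrow{C_3}$ has vertices $v_0,v_1,v_2$ and arcs $(v_0,v_1),(v_1,v_2),(v_2,v_0)$. For integers $a,b,c,d\geq0$, $\Lambda(a,b,c,d)$ is the digraph on the disjoint union $K\cup B\cup K'\cup T$ with $|K|=a$, $|B|=b$, $|K'|=c$, $|T|=d$, whose arcs are: all ordered pairs of distinct vertices inside $K$ and inside $K'$; no arcs inside $B$ or inside $T$; all arcs from $K$ to $B$, from $B$ to $K'$, from $K'$ to $T$, from $T$ to $K$, from $B$ to $T$ and from $T$ to $B$; and no other arcs. -}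

module Defs where

open import Data.Nat as ℕ using (ℕ; zero; suc)
open import Data.Integer as ℤ using (ℤ; +_)
open import Data.Fin as Fin using (Fin; splitAt) renaming (_<_ to _<ᶠ_)
open import Data.Fin.Properties using () renaming (_≟_ to _≟ᶠ_)
open import Data.Bool using (Bool; true; false; not; if_then_else_)
open import Data.List using (List; []; _∷_)
open import Data.Sum using (_⊎_; inj₁; inj₂)
open import Data.Product using (Σ; ∃; _×_; _,_)
open import Function.Bundles using (Inverse; _↔_)
open import Relation.Nullary.Decidable using (⌊_⌋)
open import Relation.Binary.PropositionalEquality using (_≡_)
open import Level using (0ℓ)

-- Digraphs on vertex set Fin n, given by an arc relation.
-- (A Bool-valued arc relation excludes multiple arcs automatically.)

Digraph : ℕ → Set
Digraph n = Fin n → Fin n → Bool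

Loopless : ∀ {n} → Digraph n → Set
Loopless G = ∀ v → G v v ≡ false

data Walk {n} (G : Digraph n) : Fin n → Fin n → ℕ → Set where
  here : ∀ {u} → Walk G u u zero
  step : ∀ {u w v k} → G u w ≡ true → Walk G w v k → Walk G u v (suc k)

StronglyConnected : ∀ {n} → Digraph n → Set
StronglyConnected G = ∀ u v → ∃ λ k → Walk G u v k

IsDist : ∀ {n} → Digraph n → Fin n → Fin n → ℕ → Set
IsDist G u v k = Walk G u v k × (∀ j → j ℕ.< k → Walk G u v j → Data.Empty.⊥)
  where import Data.Empty

IsDistanceMatrix : ∀ {n} → Digraph n → (Fin n → Fin n → ℕ) → Set
IsDistanceMatrix G D = ∀ u v → IsDist G u v (D u v)

Iso : ∀ {n m} → Digraph n → Digraph m → Set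
Iso {n} {m} G H = Σ (Fin n ↔ Fin m) λ f →
  ∀ u v → G u v ≡ H (Inverse.to f u) (Inverse.to f v)

-- Univariate polynomials over ℤ: coefficient lists, lowest degree first.

Poly : Set
Poly = List ℤ

coeff : Poly → ℕ → ℤ
coeff []       _       = + 0
coeff (c ∷ _)  zero    = c
coeff (_ ∷ p)  (suc i) = coeff p i

_≈P_ : Poly → Poly → Set
p ≈P q = ∀ i → coeff p i ≡ coeff q i

infixl 6 _+P_ _-P_
infixl 7 _*P_ _·P_

_+P_ : Poly → Poly → Poly
[]      +P q       = q
p       +P []      = p
(a ∷ p) +P (b ∷ q) = (a ℤ.+ b) ∷ (p +P q)

_·P_ : ℤ → Poly → Poly
c ·P []      = []
c ·P (a ∷ p) = (c ℤ.* a) ∷ (c ·P p)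

-P_ : Poly → Poly
-P p = ℤ.-[1+ 0 ] ·P p

_-P_ : Poly → Poly → Poly
p -P q = p +P (-P q)

_*P_ : Poly → Poly → Poly
[]      *P q = []
(a ∷ p) *P q = (a ·P q) +P (+ 0 ∷ (p *P q))

0P 1P : Poly
0P = []
1P = + 1 ∷ []

-- the variable t is the list  0 ∷ 1 ∷ []

data InIdeal (S : Poly → Set) : Poly → Set where
  gen  : ∀ {p} → S p → InIdeal S p
  zer  : InIdeal S 0P
  add  : ∀ {p q} → InIdeal S p → InIdeal S q → InIdeal S (p +P q)
  mul  : ∀ r {p} → InIdeal S p → InIdeal S (r *P p)
  resp : ∀ {p q} → p ≈P q → InIdeal S p → InIdeal S q

IsUnitIdeal : (Poly → Set) → Set
IsUnitIdeal S = ∀ p → InIdeal S p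

tI+D : ∀ {n} → (Fin n → Fin n → ℕ) → Fin n → Fin n → Poly
tI+D D i j = if ⌊ i ≟ᶠ j ⌋ then (+ D i j ∷ + 1 ∷ []) else (+ D i j ∷ [])

Is2Minor : ∀ {n} → (Fin n → Fin n → Poly) → Poly → Set
Is2Minor {n} M p = Σ (Fin n) λ r₁ → Σ (Fin n) λ r₂ → Σ (Fin n) λ c₁ → Σ (Fin n) λ c₂ →
  r₁ <ᶠ r₂ × c₁ <ᶠ c₂ ×
  (p ≡ (M r₁ c₁ *P M r₂ c₂) -P (M r₁ c₂ *P M r₂ c₁))

U₂gens : ∀ {n} → (Fin n → Fin n → ℕ) → Poly → Set
U₂gens D = Is2Minor (tI+D D)

C3 : Digraph 3
C3 Fin.zero (Fin.suc Fin.zero) = true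
C3 (Fin.suc Fin.zero) (Fin.suc (Fin.suc Fin.zero)) = true
C3 (Fin.suc (Fin.suc Fin.zero)) Fin.zero = true
C3 _ _ = false

-- Λ(a,b,c,d) on Fin (a + b + c + d): the first a vertices form K,
-- the next b form B, the next c form K', the last d form T.

data Part : Set where
  pK pB pK' pT : Part

part : ∀ a b c d → Fin (a ℕ.+ b ℕ.+ c ℕ.+ d) → Part
part a b c d i with splitAt (a ℕ.+ b ℕ.+ c) i
... | inj₂ _ = pT
... | inj₁ j with splitAt (a ℕ.+ b) j
...   | inj₂ _ = pK'
...   | inj₁ k with splitAt a k
...     | inj₁ _ = pK
...     | inj₂ _ = pB

partArc : Part → Part → Bool
partArc pK  pK  = true
partArc pK' pK' = true
partArc pK  pB  = true
partArc pB  pK' = true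
partArc pK' pT  = true
partArc pT  pK  = true
partArc pB  pT  = true
partArc pT  pB  = true
partArc _   _   = false

Λ : ∀ a b c d → Digraph (a ℕ.+ b ℕ.+ c ℕ.+ d)
Λ a b c d u v = if ⌊ u ≟ᶠ v ⌋ then false else partArc (part a b c d u) (part a b c d v)

-- Write I for U₂(G). For distinct u, j, k the minor of tI + D on rows u, j and columns j, k is
-- D(u,j)·D(j,k) − D(u,k)·t, and the one on rows and columns u, w is t² − D(u,w)·D(w,u).
-- Suppose 1 ∉ I. A distance of 3 or more would, along a shortest walk, give 1 − 2t, 2 − 3t ∈ I and
-- so 1 ∈ I; hence all distances are 1 or 2. If all are 1, G is complete, i.e. Λ(n,0,0,0). Otherwise
-- 1 − 2t ∈ I. A digon adds t² − 1, so that 3 ∈ I and t ≡ −1 modulo I; the path minors then show that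
-- the out-neighbourhood of a vertex splits G as a complete bipartite digraph Λ(0,b,0,d). Without
-- digons, t² − 2 ∈ I gives 7 ∈ I, and the path minors force G to be the directed triangle.
-- Conversely, for each of these digraphs, tI + D evaluated at t = 1, 2, 4 is a matrix of rank one
-- modulo 2, 3, 7 respectively, so every minor evaluates to a multiple of that modulus, and 1 does not.

{-# OPTIONS --safe #-}
module Submission where

open import Defs

open import Data.Bool using (Bool; true; false; T; _∧_; _xor_; not; if_then_else_)
open import Data.Bool.Properties using (xor-same; not-¬; not-involutive)
open import Data.Empty using (⊥; ⊥-elim)
open import Data.Fin as Fin using (Fin; cast)
open import Data.Fin.Patterns using (0F; 1F; 2F)
open import Data.Fin.Properties
  using (<-cmp; any?; +↔⊎; cast-involutive; nonZeroIndex) renaming (_≟_ to _≟ᶠ_)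
open import Data.Integer as ℤ using (ℤ; +_; -[1+_]; _+_; _*_; _-_; -_)
open import Data.Integer.Divisibility.Signed
  using (_∣_; divides; ∣m∣n⇒∣m+n; ∣m∣n⇒∣m-n; ∣m⇒∣m*n; ∣n⇒∣m*n; ∣⇒∣ᵤ)
import Data.Integer.Properties as ℤ
open import Data.Integer.Tactic.RingSolver using (solve-∀)
open import Data.List using ([]; _∷_)
open import Data.Nat as ℕ using (ℕ; zero; suc; _<_; _≤_; _≥_; s≤s)
open import Data.Nat.Divisibility using (∣1⇒≡1)
import Data.Nat.Properties as ℕ
open import Data.Product using (Σ; ∃; _×_; _,_; proj₁; proj₂; map₂)
open import Data.Sum using (_⊎_; inj₁; inj₂; [_,_]′; map₁; swap)
open import Data.Sum.Algebra using (⊎-cong; ⊎-comm)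
open import Data.Unit using (tt)
open import Function using (case_of_; _∘_; id)
open import Function.Bundles using (Inverse; _↔_; mk↔ₛ′; Injection; _⇔_; mk⇔)
open import Function.Properties.Inverse using (↔-sym; ↔-trans; ↔-refl; ↔⇒↣)
open import Relation.Binary.Definitions using (tri<; tri≈; tri>)
open import Relation.Binary.PropositionalEquality hiding (resp)
open import Relation.Nullary using (¬_)
open import Relation.Nullary.Decidable
  using (⌊_⌋; yes; no; does; dec-true; dec-false; _×-dec_; toSum)

-- Polynomial arithmetic

t : Poly
t = + 0 ∷ + 1 ∷ []

infix 4 _==P_

_==P_ : Poly → Poly → Bool
[]      ==P []      = true
[]      ==P (b ∷ q) = ⌊ b ℤ.≟ + 0 ⌋ ∧ ([] ==P q)
(a ∷ p) ==P []      = ⌊ a ℤ.≟ + 0 ⌋ ∧ (p ==P [])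
(a ∷ p) ==P (b ∷ q) = ⌊ a ℤ.≟ b ⌋ ∧ (p ==P q)

==P-sound : ∀ p q → T (p ==P q) → p ≈P q
==P-sound []      []      _ _ = refl
==P-sound []      (b ∷ q) h i with b ℤ.≟ + 0 | i
... | yes refl | zero  = refl
... | yes refl | suc i = ==P-sound [] q h i
==P-sound (a ∷ p) []      h i with a ℤ.≟ + 0 | i
... | yes refl | zero  = refl
... | yes refl | suc i = ==P-sound p [] h i
==P-sound (a ∷ p) (b ∷ q) h i with a ℤ.≟ b | i
... | yes refl | zero  = refl
... | yes refl | suc i = ==P-sound p q h i

coeff-+P : ∀ p q i → coeff (p +P q) i ≡ coeff p i + coeff q i
coeff-+P []      q       i       = sym (ℤ.+-identityˡ _)
coeff-+P (a ∷ p) []      i       = sym (ℤ.+-identityʳ _)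
coeff-+P (a ∷ p) (b ∷ q) zero    = refl
coeff-+P (a ∷ p) (b ∷ q) (suc i) = coeff-+P p q i

coeff-·P : ∀ c p i → coeff (c ·P p) i ≡ c * coeff p i
coeff-·P c []      i       = sym (ℤ.*-zeroʳ c)
coeff-·P c (a ∷ p) zero    = refl
coeff-·P c (a ∷ p) (suc i) = coeff-·P c p i

coeff--P : ∀ p q i → coeff (p -P q) i ≡ coeff p i - coeff q i
coeff--P p q i = begin
  coeff (p -P q) i                 ≡⟨ coeff-+P p (-P q) i ⟩
  coeff p i + coeff (-P q) i       ≡⟨ cong (_+_ (coeff p i)) (coeff-·P -[1+ 0 ] q i) ⟩
  coeff p i + -[1+ 0 ] * coeff q i ≡⟨ cong (_+_ (coeff p i)) (ℤ.-1*i≡-i (coeff q i)) ⟩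
  coeff p i - coeff q i            ∎
  where open ≡-Reasoning

*P-constˡ : ∀ c p → ((c ∷ []) *P p) ≈P (c ·P p)
*P-constˡ c p i = begin
  coeff (c ·P p +P (+ 0 ∷ [])) i        ≡⟨ coeff-+P (c ·P p) (+ 0 ∷ []) i ⟩
  coeff (c ·P p) i + coeff (+ 0 ∷ []) i ≡⟨ cong (_+_ (coeff (c ·P p) i)) (coeff-0 i) ⟩
  coeff (c ·P p) i + + 0                ≡⟨ ℤ.+-identityʳ _ ⟩
  coeff (c ·P p) i                      ∎
  where
  open ≡-Reasoning
  coeff-0 : ∀ i → coeff (+ 0 ∷ []) i ≡ + 0
  coeff-0 zero    = refl
  coeff-0 (suc i) = refl

*P-zeroʳ : ∀ p → (p *P []) ≈P []
*P-zeroʳ []      _       = refl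
*P-zeroʳ (a ∷ p) zero    = refl
*P-zeroʳ (a ∷ p) (suc i) = *P-zeroʳ p i

*P-∷ʳ : ∀ p b q → (p *P (b ∷ q)) ≈P (b ·P p +P (+ 0 ∷ p *P q))
*P-∷ʳ []      b q zero    = refl
*P-∷ʳ []      b q (suc i) = refl
*P-∷ʳ (a ∷ p) b q zero    = cong (_+ + 0) (ℤ.*-comm a b)
*P-∷ʳ (a ∷ p) b q (suc i) = begin
  coeff (a ·P q +P p *P (b ∷ q)) i ≡⟨ coeff-+P (a ·P q) _ i ⟩
  A + coeff (p *P (b ∷ q)) i       ≡⟨ cong (_+_ A) (*P-∷ʳ p b q i) ⟩
  A + coeff (b ·P p +P s) i        ≡⟨ cong (_+_ A) (coeff-+P (b ·P p) s i) ⟩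
  A + (B + coeff s i)              ≡⟨ swap-middle A B (coeff s i) ⟩
  B + (A + coeff s i)              ≡⟨ cong (_+_ B) (coeff-+P (a ·P q) s i) ⟨
  B + coeff (a ·P q +P s) i        ≡⟨ coeff-+P (b ·P p) (a ·P q +P s) i ⟨
  coeff (b ·P p +P (a ·P q +P s)) i ∎
  where
  open ≡-Reasoning
  s = + 0 ∷ p *P q
  A = coeff (a ·P q) i
  B = coeff (b ·P p) i
  swap-middle : ∀ x y z → x + (y + z) ≡ y + (x + z)
  swap-middle = solve-∀

*P-comm : ∀ p q → (p *P q) ≈P (q *P p)
*P-comm []      q i = sym (*P-zeroʳ q i)
*P-comm (a ∷ p) q i = begin
  coeff (a ·P q +P (+ 0 ∷ p *P q)) i        ≡⟨ coeff-+P (a ·P q) _ i ⟩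
  coeff (a ·P q) i + coeff (+ 0 ∷ p *P q) i ≡⟨ cong (_+_ (coeff (a ·P q) i)) (tail-comm i) ⟩
  coeff (a ·P q) i + coeff (+ 0 ∷ q *P p) i ≡⟨ coeff-+P (a ·P q) _ i ⟨
  coeff (a ·P q +P (+ 0 ∷ q *P p)) i        ≡⟨ *P-∷ʳ q a p i ⟨
  coeff (q *P (a ∷ p)) i                    ∎
  where
  open ≡-Reasoning
  tail-comm : ∀ i → coeff (+ 0 ∷ p *P q) i ≡ coeff (+ 0 ∷ q *P p) i
  tail-comm zero    = refl
  tail-comm (suc i) = *P-comm p q i

ev : ℤ → Poly → ℤ
ev τ []      = + 0
ev τ (a ∷ p) = a + τ * ev τ p

ev-+P : ∀ τ p q → ev τ (p +P q) ≡ ev τ p + ev τ q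
ev-+P τ []      q       = sym (ℤ.+-identityˡ _)
ev-+P τ (a ∷ p) []      = sym (ℤ.+-identityʳ _)
ev-+P τ (a ∷ p) (b ∷ q) = begin
  (a + b) + τ * ev τ (p +P q)         ≡⟨ cong (λ x → (a + b) + τ * x) (ev-+P τ p q) ⟩
  (a + b) + τ * (ev τ p + ev τ q)     ≡⟨ regroup a b τ (ev τ p) (ev τ q) ⟩
  (a + τ * ev τ p) + (b + τ * ev τ q) ∎
  where
  open ≡-Reasoning
  regroup : ∀ a b τ x y → (a + b) + τ * (x + y) ≡ (a + τ * x) + (b + τ * y)
  regroup = solve-∀

ev-·P : ∀ τ c p → ev τ (c ·P p) ≡ c * ev τ p
ev-·P τ c []      = sym (ℤ.*-zeroʳ c)
ev-·P τ c (a ∷ p) = begin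
  c * a + τ * ev τ (c ·P p) ≡⟨ cong (λ x → c * a + τ * x) (ev-·P τ c p) ⟩
  c * a + τ * (c * ev τ p)  ≡⟨ regroup c a τ (ev τ p) ⟩
  c * (a + τ * ev τ p)      ∎
  where
  open ≡-Reasoning
  regroup : ∀ c a τ x → c * a + τ * (c * x) ≡ c * (a + τ * x)
  regroup = solve-∀

ev-*P : ∀ τ p q → ev τ (p *P q) ≡ ev τ p * ev τ q
ev-*P τ []      q = sym (ℤ.*-zeroˡ (ev τ q))
ev-*P τ (a ∷ p) q = begin
  ev τ (a ·P q +P (+ 0 ∷ p *P q))
    ≡⟨ ev-+P τ (a ·P q) _ ⟩
  ev τ (a ·P q) + (+ 0 + τ * ev τ (p *P q))
    ≡⟨ cong₂ (λ x y → x + (+ 0 + τ * y)) (ev-·P τ a q) (ev-*P τ p q) ⟩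
  a * ev τ q + (+ 0 + τ * (ev τ p * ev τ q))
    ≡⟨ regroup a τ (ev τ p) (ev τ q) ⟩
  (a + τ * ev τ p) * ev τ q
    ∎
  where
  open ≡-Reasoning
  regroup : ∀ a τ x y → a * y + (+ 0 + τ * (x * y)) ≡ (a + τ * x) * y
  regroup = solve-∀

ev-≈P-[] : ∀ τ p → p ≈P [] → ev τ p ≡ + 0
ev-≈P-[] τ []      _   = refl
ev-≈P-[] τ (a ∷ p) p≈0 = begin
  a + τ * ev τ p ≡⟨ cong₂ (λ x y → x + τ * y) (p≈0 0) (ev-≈P-[] τ p (p≈0 ∘ suc)) ⟩
  + 0 + τ * + 0  ≡⟨ cong (_+_ (+ 0)) (ℤ.*-zeroʳ τ) ⟩
  + 0            ∎
  where open ≡-Reasoning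

ev-resp-≈P : ∀ τ {p q} → p ≈P q → ev τ p ≡ ev τ q
ev-resp-≈P τ {[]}    {q}     p≈q = sym (ev-≈P-[] τ q (sym ∘ p≈q))
ev-resp-≈P τ {a ∷ p} {[]}    p≈q = ev-≈P-[] τ (a ∷ p) p≈q
ev-resp-≈P τ {a ∷ p} {b ∷ q} p≈q =
  cong₂ (λ x y → x + τ * y) (p≈q 0) (ev-resp-≈P τ {p} {q} (p≈q ∘ suc))

ev--P : ∀ τ p q → ev τ (p -P q) ≡ ev τ p - ev τ q
ev--P τ p q = begin
  ev τ (p +P -P q)                ≡⟨ ev-+P τ p (-P q) ⟩
  ev τ p + ev τ (-P q)            ≡⟨ cong (_+_ (ev τ p)) (ev-·P τ -[1+ 0 ] q) ⟩
  ev τ p + -[1+ 0 ] * ev τ q      ≡⟨ cong (_+_ (ev τ p)) (ℤ.-1*i≡-i (ev τ q)) ⟩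
  ev τ p - ev τ q                 ∎
  where open ≡-Reasoning

-- Ideals

module _ {S : Poly → Set} where

  1∈⇒unit : InIdeal S 1P → IsUnitIdeal S
  1∈⇒unit 1∈ p = resp p*1≈p (mul p 1∈)
    where
    p*1≈p : (p *P 1P) ≈P p
    p*1≈p i = begin
      coeff (p *P 1P) i      ≡⟨ *P-comm p 1P i ⟩
      coeff (1P *P p) i      ≡⟨ *P-constˡ (+ 1) p i ⟩
      coeff (+ 1 ·P p) i     ≡⟨ coeff-·P (+ 1) p i ⟩
      + 1 * coeff p i        ≡⟨ ℤ.*-identityˡ (coeff p i) ⟩
      coeff p i              ∎
      where open ≡-Reasoning

  neg∈ : ∀ {p q} → InIdeal S p → q ≈P (-P p) → InIdeal S q
  neg∈ {p} p∈ q≈-p =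
    resp (λ i → trans (*P-constˡ -[1+ 0 ] p i) (sym (q≈-p i))) (mul (-[1+ 0 ] ∷ []) p∈)

  -- At concrete polynomials the implicit proof has type ⊤ exactly when the identity holds,
  -- so Agda fills it in.
  lincomb∈ : ∀ a b {p q r} → InIdeal S p → InIdeal S q →
             {_ : T (r ==P (a *P p +P b *P q))} → InIdeal S r
  lincomb∈ a b {r = r} p∈ q∈ {r==} =
    resp (λ i → sym (==P-sound r _ r== i)) (add (mul a p∈) (mul b q∈))

  InIdeal⇒ev-∣ : ∀ τ m → (∀ {p} → S p → m ∣ ev τ p) →
                 ∀ {p} → InIdeal S p → m ∣ ev τ p
  InIdeal⇒ev-∣ τ m S∣ (gen p∈S) = S∣ p∈S
  InIdeal⇒ev-∣ τ m S∣ zer       = divides (+ 0) refl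
  InIdeal⇒ev-∣ τ m S∣ (add {p} {q} p∈ q∈) =
    subst (m ∣_) (sym (ev-+P τ p q))
          (∣m∣n⇒∣m+n (InIdeal⇒ev-∣ τ m S∣ p∈) (InIdeal⇒ev-∣ τ m S∣ q∈))
  InIdeal⇒ev-∣ τ m S∣ (mul r {p} p∈) =
    subst (m ∣_) (sym (ev-*P τ r p)) (∣n⇒∣m*n (ev τ r) (InIdeal⇒ev-∣ τ m S∣ p∈))
  InIdeal⇒ev-∣ τ m S∣ (resp {p} {q} p≈q p∈) =
    subst (m ∣_) (ev-resp-≈P τ {p} {q} p≈q) (InIdeal⇒ev-∣ τ m S∣ p∈)

  ev-∣⇒¬unit : ∀ τ m → ¬ m ∣ + 1 → (∀ {p} → S p → m ∣ ev τ p) → ¬ IsUnitIdeal S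
  ev-∣⇒¬unit τ m m∤1 S∣ unit = m∤1 (subst (m ∣_) ev-1 (InIdeal⇒ev-∣ τ m S∣ (unit 1P)))
    where
    ev-1 : ev τ 1P ≡ + 1
    ev-1 = cong (_+_ (+ 1)) (ℤ.*-zeroʳ τ)

2+k∤1 : ∀ k → ¬ + suc (suc k) ∣ + 1
2+k∤1 k d = case ∣1⇒≡1 (∣⇒∣ᵤ d) of λ ()

-- Two-by-two minors

minor : ∀ {n} → (Fin n → Fin n → Poly) → (r₁ r₂ c₁ c₂ : Fin n) → Poly
minor M r₁ r₂ c₁ c₂ = (M r₁ c₁ *P M r₂ c₂) -P (M r₁ c₂ *P M r₂ c₁)

module _ {n} (M : Fin n → Fin n → Poly) where

  minor-swapᶜ : ∀ r₁ r₂ c₁ c₂ → minor M r₁ r₂ c₂ c₁ ≈P (-P minor M r₁ r₂ c₁ c₂)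
  minor-swapᶜ r₁ r₂ c₁ c₂ i = begin
    coeff (minor M r₁ r₂ c₂ c₁) i
      ≡⟨ coeff--P (M r₁ c₂ *P M r₂ c₁) _ i ⟩
    y - x
      ≡⟨ flip-sign x y ⟩
    -[1+ 0 ] * (x - y)
      ≡⟨ cong (-[1+ 0 ] *_) (coeff--P (M r₁ c₁ *P M r₂ c₂) _ i) ⟨
    -[1+ 0 ] * coeff (minor M r₁ r₂ c₁ c₂) i
      ≡⟨ coeff-·P -[1+ 0 ] (minor M r₁ r₂ c₁ c₂) i ⟨
    coeff (-P minor M r₁ r₂ c₁ c₂) i
      ∎
    where
    open ≡-Reasoning
    x = coeff (M r₁ c₁ *P M r₂ c₂) i
    y = coeff (M r₁ c₂ *P M r₂ c₁) i
    flip-sign : ∀ x y → y - x ≡ -[1+ 0 ] * (x - y)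
    flip-sign = solve-∀

  minor-swapʳ : ∀ r₁ r₂ c₁ c₂ → minor M r₂ r₁ c₁ c₂ ≈P (-P minor M r₁ r₂ c₁ c₂)
  minor-swapʳ r₁ r₂ c₁ c₂ i = begin
    coeff (minor M r₂ r₁ c₁ c₂) i
      ≡⟨ coeff--P (M r₂ c₁ *P M r₁ c₂) _ i ⟩
    coeff (M r₂ c₁ *P M r₁ c₂) i - coeff (M r₂ c₂ *P M r₁ c₁) i
      ≡⟨ cong₂ _-_ (*P-comm (M r₂ c₁) _ i) (*P-comm (M r₂ c₂) _ i) ⟩
    coeff (M r₁ c₂ *P M r₂ c₁) i - coeff (M r₁ c₁ *P M r₂ c₂) i
      ≡⟨ coeff--P (M r₁ c₂ *P M r₂ c₁) _ i ⟨
    coeff (minor M r₁ r₂ c₂ c₁) i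
      ≡⟨ minor-swapᶜ r₁ r₂ c₁ c₂ i ⟩
    coeff (-P minor M r₁ r₂ c₁ c₂) i
      ∎
    where open ≡-Reasoning

  minor-swap : ∀ r₁ r₂ c₁ c₂ → minor M r₂ r₁ c₂ c₁ ≈P minor M r₁ r₂ c₁ c₂
  minor-swap r₁ r₂ c₁ c₂ i = begin
    coeff (minor M r₂ r₁ c₂ c₁) i
      ≡⟨ coeff--P (M r₂ c₂ *P M r₁ c₁) _ i ⟩
    coeff (M r₂ c₂ *P M r₁ c₁) i - coeff (M r₂ c₁ *P M r₁ c₂) i
      ≡⟨ cong₂ _-_ (*P-comm (M r₂ c₂) _ i) (*P-comm (M r₂ c₁) _ i) ⟩
    coeff (M r₁ c₁ *P M r₂ c₂) i - coeff (M r₁ c₂ *P M r₂ c₁) i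
      ≡⟨ coeff--P (M r₁ c₁ *P M r₂ c₂) _ i ⟨
    coeff (minor M r₁ r₂ c₁ c₂) i
      ∎
    where open ≡-Reasoning

  minor∈ : ∀ {r₁ r₂ c₁ c₂} → r₁ ≢ r₂ → c₁ ≢ c₂ →
           InIdeal (Is2Minor M) (minor M r₁ r₂ c₁ c₂)
  minor∈ {r₁} {r₂} {c₁} {c₂} r₁≢r₂ c₁≢c₂ with <-cmp r₁ r₂ | <-cmp c₁ c₂
  ... | tri≈ _ r₁≡r₂ _ | _              = ⊥-elim (r₁≢r₂ r₁≡r₂)
  ... | _              | tri≈ _ c₁≡c₂ _ = ⊥-elim (c₁≢c₂ c₁≡c₂)
  ... | tri< r₁<r₂ _ _ | tri< c₁<c₂ _ _ = gen (r₁ , r₂ , c₁ , c₂ , r₁<r₂ , c₁<c₂ , refl)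
  ... | tri> _ _ r₂<r₁ | tri< c₁<c₂ _ _ =
    neg∈ (gen (r₂ , r₁ , c₁ , c₂ , r₂<r₁ , c₁<c₂ , refl)) (minor-swapʳ r₂ r₁ c₁ c₂)
  ... | tri< r₁<r₂ _ _ | tri> _ _ c₂<c₁ =
    neg∈ (gen (r₁ , r₂ , c₂ , c₁ , r₁<r₂ , c₂<c₁ , refl)) (minor-swapᶜ r₁ r₂ c₂ c₁)
  ... | tri> _ _ r₂<r₁ | tri> _ _ c₂<c₁ =
    resp (minor-swap r₁ r₂ c₁ c₂) (gen (r₂ , r₁ , c₂ , c₁ , r₂<r₁ , c₂<c₁ , refl))

  ev-minor : ∀ τ r₁ r₂ c₁ c₂ → ev τ (minor M r₁ r₂ c₁ c₂) ≡
             ev τ (M r₁ c₁) * ev τ (M r₂ c₂) - ev τ (M r₁ c₂) * ev τ (M r₂ c₁)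
  ev-minor τ r₁ r₂ c₁ c₂ = trans (ev--P τ (M r₁ c₁ *P M r₂ c₂) (M r₁ c₂ *P M r₂ c₁))
                                 (cong₂ _-_ (ev-*P τ (M r₁ c₁) _) (ev-*P τ (M r₁ c₂) _))

  rank-one-mod⇒minor-∣ : ∀ τ m (x y : Fin n → ℤ) →
                          (∀ u v → m ∣ ev τ (M u v) - x u * y v) →
                          ∀ {p} → Is2Minor M p → m ∣ ev τ p
  rank-one-mod⇒minor-∣ τ m x y ≡xy (r₁ , r₂ , c₁ , c₂ , _ , _ , refl) =
    subst (m ∣_) (sym (trans (ev-minor τ r₁ r₂ c₁ c₂) (expand A B C E (x r₁) (x r₂) (y c₁) (y c₂))))
      (∣m∣n⇒∣m-n
        (∣m∣n⇒∣m+n (∣m⇒∣m*n B (≡xy r₁ c₁)) (∣n⇒∣m*n (x r₁ * y c₁) (≡xy r₂ c₂)))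
        (∣m∣n⇒∣m+n (∣m⇒∣m*n E (≡xy r₁ c₂)) (∣n⇒∣m*n (x r₁ * y c₂) (≡xy r₂ c₁))))
    where
    A = ev τ (M r₁ c₁)
    B = ev τ (M r₂ c₂)
    C = ev τ (M r₁ c₂)
    E = ev τ (M r₂ c₁)
    expand : ∀ A B C E x₁ x₂ y₁ y₂ → A * B - C * E ≡
               ((A - x₁ * y₁) * B + x₁ * y₁ * (B - x₂ * y₂))
             - ((C - x₁ * y₂) * E + x₁ * y₂ * (E - x₂ * y₁))
    expand = solve-∀

-- Digraphs, walks and isomorphisms

_++ʷ_ : ∀ {n} {G : Digraph n} {u v w k m} → Walk G u v k → Walk G v w m → Walk G u w (k ℕ.+ m)
here      ++ʷ q = q
step uv p ++ʷ q = step uv (p ++ʷ q)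

walk-0 : ∀ {n} {G : Digraph n} {u v} → Walk G u v 0 → u ≡ v
walk-0 here = refl

walk-1 : ∀ {n} {G : Digraph n} {u v} → Walk G u v 1 → G u v ≡ true
walk-1 (step uv here) = uv

arc⇒≢ : ∀ {n} {G : Digraph n} → Loopless G → ∀ {u v} → G u v ≡ true → u ≢ v
arc⇒≢ loopless {u} uv refl = case trans (sym uv) (loopless u) of λ ()

IsComplete : ∀ {n} → Digraph n → Set
IsComplete G = ∀ u v → u ≢ v → G u v ≡ true

IsCompleteBipartite : ∀ {n} → Digraph n → (Fin n → Bool) → Set
IsCompleteBipartite G side = ∀ u v → u ≢ v → G u v ≡ side u xor side v

data Shape {n} (G : Digraph n) : Set where
  complete  : IsComplete G → Shape G
  bipartite : (side : Fin n → Bool) →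
              ∃ (λ u → side u ≡ false) → ∃ (λ v → side v ≡ true) →
              IsCompleteBipartite G side → Shape G
  cycle     : Iso C3 G → Shape G

↔-≢ : ∀ {A B : Set} (f : A ↔ B) {x y} → x ≢ y → Inverse.to f x ≢ Inverse.to f y
↔-≢ f x≢y = x≢y ∘ Injection.injective (↔⇒↣ f)

module _ {n m} {G : Digraph n} {H : Digraph m} where

  Iso-sym : Iso G H → Iso H G
  Iso-sym (f , arcs) = ↔-sym f , λ x y →
    sym (trans (arcs (from x) (from y)) (cong₂ H (strictlyInverseˡ x) (strictlyInverseˡ y)))
    where open Inverse f

  Iso-walk : (iso : Iso G H) → ∀ {u v k} → Walk G u v k →
             Walk H (Inverse.to (proj₁ iso) u) (Inverse.to (proj₁ iso) v) k
  Iso-walk iso            here                = here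
  Iso-walk iso@(_ , arcs) (step {u} {w} uw p) = step (trans (sym (arcs u w)) uw) (Iso-walk iso p)

  Iso-stronglyConnected : Iso G H → StronglyConnected G → StronglyConnected H
  Iso-stronglyConnected iso@(f , _) sc x y = map₂ transport (sc (from x) (from y))
    where
    open Inverse f
    transport : ∀ {k} → Walk G (from x) (from y) k → Walk H x y k
    transport p =
      subst₂ (λ x′ y′ → Walk H x′ y′ _) (strictlyInverseˡ x) (strictlyInverseˡ y) (Iso-walk iso p)

  Iso-offdiagonal : (f : Fin n ↔ Fin m) → Loopless G → Loopless H →
                    (∀ u v → u ≢ v → G u v ≡ H (Inverse.to f u) (Inverse.to f v)) → Iso G H
  Iso-offdiagonal f loopG loopH off = f , arcs
    where
    arcs : ∀ u v → G u v ≡ H (Inverse.to f u) (Inverse.to f v)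
    arcs u v with u ≟ᶠ v
    ... | yes refl = trans (loopG u) (sym (loopH (Inverse.to f u)))
    ... | no u≢v   = off u v u≢v

  IsComplete-transport : Iso G H → IsComplete H → IsComplete G
  IsComplete-transport (f , arcs) completeH u v u≢v = trans (arcs u v) (completeH _ _ (↔-≢ f u≢v))

  IsCompleteBipartite-transport : ∀ {side} → (iso : Iso G H) → IsCompleteBipartite H side →
                                  IsCompleteBipartite G (side ∘ Inverse.to (proj₁ iso))
  IsCompleteBipartite-transport (f , arcs) bipH u v u≢v = trans (arcs u v) (bipH _ _ (↔-≢ f u≢v))

module _ {n m} {G : Digraph n} {H : Digraph m} (loopG : Loopless G) (loopH : Loopless H) where

  complete-Iso : IsComplete G → IsComplete H → Fin n ↔ Fin m → Iso G H
  complete-Iso completeG completeH f = Iso-offdiagonal {G = G} {H = H} f loopG loopH λ u v u≢v →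
    trans (completeG u v u≢v) (sym (completeH _ _ (↔-≢ f u≢v)))

  completeBipartite-Iso : ∀ {sideG sideH} → IsCompleteBipartite G sideG → IsCompleteBipartite H sideH →
                          (f : Fin n ↔ Fin m) → (∀ u → sideH (Inverse.to f u) ≡ sideG u) → Iso G H
  completeBipartite-Iso bipG bipH f preserves = Iso-offdiagonal {G = G} {H = H} f loopG loopH λ u v u≢v →
    trans (bipG u v u≢v)
          (trans (sym (cong₂ _xor_ (preserves u) (preserves v))) (sym (bipH _ _ (↔-≢ f u≢v))))

Iso-C3 : ∀ {n} {G : Digraph n} → Loopless G →
         ∀ {a b c} → (∀ u → u ≡ a ⊎ u ≡ b ⊎ u ≡ c) →
         G a b ≡ true → G b c ≡ true → G c a ≡ true →
         G b a ≡ false → G c b ≡ false → G a c ≡ false → Iso C3 G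
Iso-C3 {n} {G} loopless {a} {b} {c} cover ab bc ca ba cb ac = mk↔ₛ′ to from to∘from from∘to , arcs
  where
  to : Fin 3 → Fin n
  to 0F = a
  to 1F = b
  to 2F = c

  from : Fin n → Fin 3
  from u = if does (u ≟ᶠ a) then 0F else if does (u ≟ᶠ b) then 1F else 2F

  a≢b = arc⇒≢ loopless ab
  b≢c = arc⇒≢ loopless bc
  c≢a = arc⇒≢ loopless ca

  from∘to : ∀ x → from (to x) ≡ x
  from∘to 0F rewrite dec-true (a ≟ᶠ a) refl = refl
  from∘to 1F rewrite dec-false (b ≟ᶠ a) (a≢b ∘ sym) | dec-true (b ≟ᶠ b) refl = refl
  from∘to 2F rewrite dec-false (c ≟ᶠ a) c≢a | dec-false (c ≟ᶠ b) (b≢c ∘ sym) = refl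

  to∘from : ∀ u → to (from u) ≡ u
  to∘from u with cover u
  ... | inj₁ refl        = cong to (from∘to 0F)
  ... | inj₂ (inj₁ refl) = cong to (from∘to 1F)
  ... | inj₂ (inj₂ refl) = cong to (from∘to 2F)

  arcs : ∀ x y → C3 x y ≡ G (to x) (to y)
  arcs 0F 0F = sym (loopless a)
  arcs 0F 1F = sym ab
  arcs 0F 2F = sym ac
  arcs 1F 0F = sym ba
  arcs 1F 1F = sym (loopless b)
  arcs 1F 2F = sym bc
  arcs 2F 0F = sym ca
  arcs 2F 1F = sym cb
  arcs 2F 2F = sym (loopless c)

-- The digraphs Λ(a, b, c, d)

regions : ∀ a b c d → Fin (a ℕ.+ b ℕ.+ c ℕ.+ d) ↔ (((Fin a ⊎ Fin b) ⊎ Fin c) ⊎ Fin d)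
regions a b c d = ↔-trans +↔⊎ (⊎-cong (↔-trans +↔⊎ (⊎-cong +↔⊎ ↔-refl)) ↔-refl)

region : ∀ {a b c d} → ((Fin a ⊎ Fin b) ⊎ Fin c) ⊎ Fin d → Part
region (inj₁ (inj₁ (inj₁ _))) = pK
region (inj₁ (inj₁ (inj₂ _))) = pB
region (inj₁ (inj₂ _))        = pK'
region (inj₂ _)               = pT

part-region : ∀ a b c d x → part a b c d x ≡ region (Inverse.to (regions a b c d) x)
part-region a b c d x with Fin.splitAt (a ℕ.+ b ℕ.+ c) x
... | inj₂ _ = refl
... | inj₁ y with Fin.splitAt (a ℕ.+ b) y
...   | inj₂ _ = refl
...   | inj₁ z with Fin.splitAt a z
...     | inj₁ _ = refl
...     | inj₂ _ = refl

Λ-loopless : ∀ a b c d → Loopless (Λ a b c d)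
Λ-loopless a b c d x with x ≟ᶠ x
... | yes _   = refl
... | no x≢x  = ⊥-elim (x≢x refl)

Λ-off : ∀ a b c d {x y} → x ≢ y → Λ a b c d x y ≡
        partArc (region (Inverse.to (regions a b c d) x)) (region (Inverse.to (regions a b c d) y))
Λ-off a b c d {x} {y} x≢y with x ≟ᶠ y
... | yes x≡y = ⊥-elim (x≢y x≡y)
... | no _    = cong₂ partArc (part-region a b c d x) (part-region a b c d y)

Λ-K-complete : ∀ a → IsComplete (Λ a 0 0 0)
Λ-K-complete a x y x≢y = trans (Λ-off a 0 0 0 x≢y) (cong₂ partArc (only-K _) (only-K _))
  where
  only-K : (s : ((Fin a ⊎ Fin 0) ⊎ Fin 0) ⊎ Fin 0) → region s ≡ pK
  only-K (inj₁ (inj₁ (inj₁ _))) = refl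

Λ-K′-complete : ∀ c → IsComplete (Λ 0 0 c 0)
Λ-K′-complete c x y x≢y = trans (Λ-off 0 0 c 0 x≢y) (cong₂ partArc (only-K′ _) (only-K′ _))
  where
  only-K′ : (s : ((Fin 0 ⊎ Fin 0) ⊎ Fin c) ⊎ Fin 0) → region s ≡ pK'
  only-K′ (inj₁ (inj₁ (inj₁ ())))
  only-K′ (inj₁ (inj₁ (inj₂ ())))
  only-K′ (inj₁ (inj₂ _)) = refl

isInj₂ : ∀ {A B : Set} → A ⊎ B → Bool
isInj₂ = [ (λ _ → false) , (λ _ → true) ]′

Λ-side : ∀ {b d} → Fin (0 ℕ.+ b ℕ.+ 0 ℕ.+ d) → Bool
Λ-side {b} {d} = isInj₂ ∘ Inverse.to (regions 0 b 0 d)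

Λ-BT-completeBipartite : ∀ b d → IsCompleteBipartite (Λ 0 b 0 d) (Λ-side {b} {d})
Λ-BT-completeBipartite b d x y x≢y = trans (Λ-off 0 b 0 d x≢y) (B-or-T _ _)
  where
  B-or-T : ∀ (s s′ : ((Fin 0 ⊎ Fin b) ⊎ Fin 0) ⊎ Fin d) →
           partArc (region s) (region s′) ≡ isInj₂ s xor isInj₂ s′
  B-or-T (inj₁ (inj₁ (inj₂ _))) (inj₁ (inj₁ (inj₂ _))) = refl
  B-or-T (inj₁ (inj₁ (inj₂ _))) (inj₂ _)               = refl
  B-or-T (inj₂ _)               (inj₁ (inj₁ (inj₂ _))) = refl
  B-or-T (inj₂ _)               (inj₂ _)               = refl

K↔ : ∀ a → Fin a ↔ Fin (a ℕ.+ 0 ℕ.+ 0 ℕ.+ 0)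
K↔ a = mk↔ₛ′ (cast a≡) (cast (sym a≡))
             (cast-involutive a≡ (sym a≡)) (cast-involutive (sym a≡) a≡)
  where
  a≡ : a ≡ a ℕ.+ 0 ℕ.+ 0 ℕ.+ 0
  a≡ = sym (trans (ℕ.+-identityʳ _) (trans (ℕ.+-identityʳ _) (ℕ.+-identityʳ a)))

BT↔ : ∀ b d → (Fin b ⊎ Fin d) ↔ Fin (0 ℕ.+ b ℕ.+ 0 ℕ.+ d)
BT↔ b d = ↔-trans pad (↔-sym (regions 0 b 0 d))
  where
  pad : (Fin b ⊎ Fin d) ↔ (((Fin 0 ⊎ Fin b) ⊎ Fin 0) ⊎ Fin d)
  pad = mk↔ₛ′ [ inj₁ ∘ inj₁ ∘ inj₂ , inj₂ ]′ unpad
    (λ { (inj₁ (inj₁ (inj₂ _))) → refl ; (inj₂ _) → refl })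
    (λ { (inj₁ _) → refl ; (inj₂ _) → refl })
    where
    unpad : ((Fin 0 ⊎ Fin b) ⊎ Fin 0) ⊎ Fin d → Fin b ⊎ Fin d
    unpad (inj₁ (inj₁ (inj₂ x))) = inj₁ x
    unpad (inj₂ y)               = inj₂ y

Λ-side-BT↔ : ∀ {b d} s → Λ-side {b} {d} (Inverse.to (BT↔ b d) s) ≡ isInj₂ s
Λ-side-BT↔ {b} {d} (inj₁ x) = cong isInj₂ (strictlyInverseˡ (inj₁ (inj₁ (inj₂ x))))
  where open Inverse (regions 0 b 0 d)
Λ-side-BT↔ {b} {d} (inj₂ y) = cong isInj₂ (strictlyInverseˡ (inj₂ y))
  where open Inverse (regions 0 b 0 d)

record Partition {n} (p : Fin n → Bool) : Set where
  field
    lefts rights : ℕ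
    split        : Fin n ↔ (Fin lefts ⊎ Fin rights)
    sorted       : ∀ u → isInj₂ (Inverse.to split u) ≡ p u

  lefts≥1 : ∀ {u} → p u ≡ false → 1 ≤ lefts
  lefts≥1 {u} pu with Inverse.to split u | sorted u
  ... | inj₁ x | _  = ℕ.>-nonZero⁻¹ lefts {{nonZeroIndex x}}
  ... | inj₂ _ | su = case trans su pu of λ ()

  rights≥1 : ∀ {u} → p u ≡ true → 1 ≤ rights
  rights≥1 {u} pu with Inverse.to split u | sorted u
  ... | inj₁ _ | su = case trans su pu of λ ()
  ... | inj₂ y | _  = ℕ.>-nonZero⁻¹ rights {{nonZeroIndex y}}

partition-flip : ∀ {n} {p : Fin n → Bool} → Partition (not ∘ p) → Partition p
partition-flip {p = p} P = record
  { lefts  = rights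
  ; rights = lefts
  ; split  = ↔-trans split (⊎-comm _ _)
  ; sorted = λ u → trans (isInj₂-swap (Inverse.to split u))
                         (trans (cong not (sorted u)) (not-involutive (p u)))
  }
  where
  open Partition P
  isInj₂-swap : ∀ {A B : Set} (s : A ⊎ B) → isInj₂ (swap s) ≡ not (isInj₂ s)
  isInj₂-swap (inj₁ _) = refl
  isInj₂-swap (inj₂ _) = refl

partition-consˡ : ∀ {n} {p : Fin (suc n) → Bool} → p Fin.zero ≡ false →
                  Partition (p ∘ Fin.suc) → Partition p
partition-consˡ {n} {p} p₀ P = record
  { lefts  = suc lefts
  ; rights = rights
  ; split  = mk↔ₛ′ to from to∘from from∘to
  ; sorted = sorted′
  }
  where
  open Partition P
  open Inverse split using (strictlyInverseˡ; strictlyInverseʳ) renaming (to to to′; from to from′)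

  to : Fin (suc n) → Fin (suc lefts) ⊎ Fin rights
  to Fin.zero    = inj₁ Fin.zero
  to (Fin.suc u) = map₁ Fin.suc (to′ u)

  from : Fin (suc lefts) ⊎ Fin rights → Fin (suc n)
  from (inj₁ Fin.zero)    = Fin.zero
  from (inj₁ (Fin.suc x)) = Fin.suc (from′ (inj₁ x))
  from (inj₂ y)           = Fin.suc (from′ (inj₂ y))

  to∘from : ∀ s → to (from s) ≡ s
  to∘from (inj₁ Fin.zero)    = refl
  to∘from (inj₁ (Fin.suc x)) = cong (map₁ Fin.suc) (strictlyInverseˡ (inj₁ x))
  to∘from (inj₂ y)           = cong (map₁ Fin.suc) (strictlyInverseˡ (inj₂ y))

  from∘to : ∀ u → from (to u) ≡ u
  from∘to Fin.zero    = refl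
  from∘to (Fin.suc u) with to′ u in eq
  ... | inj₁ _ = cong Fin.suc (trans (cong from′ (sym eq)) (strictlyInverseʳ u))
  ... | inj₂ _ = cong Fin.suc (trans (cong from′ (sym eq)) (strictlyInverseʳ u))

  sorted′ : ∀ u → isInj₂ (to u) ≡ p u
  sorted′ Fin.zero    = sym p₀
  sorted′ (Fin.suc u) with to′ u | sorted u
  ... | inj₁ _ | su = su
  ... | inj₂ _ | su = su

partition : ∀ {n} (p : Fin n → Bool) → Partition p
partition {zero} p = record
  { lefts = 0 ; rights = 0
  ; split = mk↔ₛ′ (λ ()) [ (λ ()) , (λ ()) ]′ (λ { (inj₁ ()) ; (inj₂ ()) }) (λ ())
  ; sorted = λ ()
  }
partition {suc n} p with p Fin.zero in p₀
... | false = partition-consˡ p₀ (partition (p ∘ Fin.suc))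
... | true  = partition-flip (partition-consˡ (cong not p₀) (partition (not ∘ p ∘ Fin.suc)))

C3-or-Λ : ∀ {n} → Digraph n → Set
C3-or-Λ G = Iso G C3 ⊎
  Σ ℕ λ a → Σ ℕ λ b → Σ ℕ λ c → Σ ℕ λ d →
    StronglyConnected (Λ a b c d) × Iso G (Λ a b c d) ×
    ((a ≢ 0 × b ≡ 0 × c ≡ 0 × d ≡ 0)
     ⊎ (c ≢ 0 × a ≡ 0 × b ≡ 0 × d ≡ 0)
     ⊎ (b ≥ 1 × d ≥ 1 × a ≡ 0 × c ≡ 0))

Shape⇒C3-or-Λ : ∀ {n} {G : Digraph n} → 1 ≤ n → Loopless G → StronglyConnected G →
                Shape G → C3-or-Λ G
Shape⇒C3-or-Λ {n} 1≤n loopless sc (complete completeG) =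
  inj₂ (n , 0 , 0 , 0 , Iso-stronglyConnected iso sc , iso ,
        inj₁ (ℕ.m<n⇒n≢0 1≤n , refl , refl , refl))
  where
  iso = complete-Iso loopless (Λ-loopless n 0 0 0) completeG (Λ-K-complete n) (K↔ n)
Shape⇒C3-or-Λ 1≤n loopless sc (bipartite side (_ , su) (_ , sv) bipG) =
  inj₂ (0 , lefts , 0 , rights , Iso-stronglyConnected iso sc , iso ,
        inj₂ (inj₂ (lefts≥1 su , rights≥1 sv , refl , refl)))
  where
  open Partition (partition side)
  f = ↔-trans split (BT↔ lefts rights)
  iso = completeBipartite-Iso loopless (Λ-loopless 0 lefts 0 rights)
          {sideH = Λ-side {lefts} {rights}} bipG
          (Λ-BT-completeBipartite lefts rights) f
          (λ w → trans (Λ-side-BT↔ {lefts} {rights} (Inverse.to split w)) (sorted w))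
Shape⇒C3-or-Λ _ _ _ (cycle iso) = inj₁ (Iso-sym iso)

C3-or-Λ⇒Shape : ∀ {n} {G : Digraph n} → C3-or-Λ G → Shape G
C3-or-Λ⇒Shape (inj₁ iso) = cycle (Iso-sym iso)
C3-or-Λ⇒Shape (inj₂ (a , _ , _ , _ , _ , iso , inj₁ (_ , refl , refl , refl))) =
  complete (IsComplete-transport iso (Λ-K-complete a))
C3-or-Λ⇒Shape (inj₂ (_ , _ , c , _ , _ , iso , inj₂ (inj₁ (_ , refl , refl , refl)))) =
  complete (IsComplete-transport iso (Λ-K′-complete c))
C3-or-Λ⇒Shape
  (inj₂ (_ , _ , _ , _ , _ , iso@(f , _) , inj₂ (inj₂ (s≤s {n = b} _ , s≤s {n = d} _ , refl , refl)))) =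
  bipartite (side ∘ to) (on-side (inj₁ Fin.zero)) (on-side (inj₂ Fin.zero))
            (IsCompleteBipartite-transport {side = side} iso (Λ-BT-completeBipartite (suc b) (suc d)))
  where
  open Inverse f
  side = Λ-side {suc b} {suc d}
  on-side : ∀ s → ∃ λ u → side (to u) ≡ isInj₂ s
  on-side s = from (Inverse.to (BT↔ (suc b) (suc d)) s) ,
              trans (cong side (strictlyInverseˡ _)) (Λ-side-BT↔ {suc b} {suc d} s)

-- Distances and the ideal U₂

module Distance {n} {G : Digraph n} (loopless : Loopless G)
                {D : Fin n → Fin n → ℕ} (isDist : IsDistanceMatrix G D) where

  shortest-walk : ∀ {u v k} → D u v ≡ k → Walk G u v k
  shortest-walk {u} {v} refl = proj₁ (isDist u v)

  dist-unique : ∀ {u v k} → Walk G u v k → (∀ j → j < k → Walk G u v j → ⊥) → D u v ≡ k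
  dist-unique {u} {v} {k} w minimal with ℕ.<-cmp (D u v) k
  ... | tri< d<k _ _ = ⊥-elim (minimal (D u v) d<k (shortest-walk refl))
  ... | tri≈ _ d≡k _ = d≡k
  ... | tri> _ _ k<d = ⊥-elim (proj₂ (isDist u v) k k<d w)

  dist-refl : ∀ u → D u u ≡ 0
  dist-refl u = dist-unique here (λ _ ())

  dist≡0⇒≡ : ∀ {u v} → D u v ≡ 0 → u ≡ v
  dist≡0⇒≡ d≡0 = walk-0 (shortest-walk d≡0)

  dist-suc⇒≢ : ∀ {u v k} → D u v ≡ suc k → u ≢ v
  dist-suc⇒≢ {u} d≡suc refl = case trans (sym d≡suc) (dist-refl u) of λ ()

  arc⇒dist≡1 : ∀ {u v} → G u v ≡ true → D u v ≡ 1
  arc⇒dist≡1 uv = dist-unique (step uv here) λ where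
    zero    _           w → arc⇒≢ loopless uv (walk-0 w)
    (suc j) (s≤s ()) _

  dist≡1⇒arc : ∀ {u v} → D u v ≡ 1 → G u v ≡ true
  dist≡1⇒arc d≡1 = walk-1 (shortest-walk d≡1)

  dist≢1⇒¬arc : ∀ {u v} → D u v ≢ 1 → G u v ≡ false
  dist≢1⇒¬arc {u} {v} d≢1 with G u v in uv
  ... | true  = ⊥-elim (d≢1 (arc⇒dist≡1 uv))
  ... | false = refl

  ¬arc⇒dist≢1 : ∀ {u v} → G u v ≡ false → D u v ≢ 1
  ¬arc⇒dist≢1 ¬uv d≡1 = case trans (sym ¬uv) (dist≡1⇒arc d≡1) of λ ()

  dist≡2 : ∀ {u w v} → u ≢ v → G u v ≡ false → G u w ≡ true → G w v ≡ true → D u v ≡ 2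
  dist≡2 u≢v ¬uv uw wv = dist-unique (step uw (step wv here)) λ where
    zero          _                 w → u≢v (walk-0 w)
    (suc zero)    _                 w → case trans (sym ¬uv) (walk-1 w) of λ ()
    (suc (suc j)) (s≤s (s≤s ())) _

  dist-prefix : ∀ {u v w k m} → Walk G u v k → Walk G v w m → D u w ≡ k ℕ.+ m → D u v ≡ k
  dist-prefix {m = m} p q d≡k+m = dist-unique p λ j j<k p′ →
    proj₂ (isDist _ _) (j ℕ.+ m) (subst (j ℕ.+ m <_) (sym d≡k+m) (ℕ.+-monoˡ-< m j<k)) (p′ ++ʷ q)

  M : Fin n → Fin n → Poly
  M = tI+D D

  M-diag : ∀ u → M u u ≡ t
  M-diag u with u ≟ᶠ u
  ... | yes _   = cong (λ d → + d ∷ + 1 ∷ []) (dist-refl u)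
  ... | no u≢u  = ⊥-elim (u≢u refl)

  M-off : ∀ {u v} → u ≢ v → M u v ≡ + D u v ∷ []
  M-off {u} {v} u≢v with u ≟ᶠ v
  ... | yes u≡v = ⊥-elim (u≢v u≡v)
  ... | no _    = refl

  I : Poly → Set
  I = InIdeal (U₂gens D)

  triangle : ℕ → ℕ → ℕ → Poly
  triangle a b c = + a * + b ∷ - + c ∷ []

  digon : ℕ → ℕ → Poly
  digon a b = - (+ a * + b) ∷ + 0 ∷ + 1 ∷ []

  triangle-minor : ∀ {u j k} → u ≢ j → j ≢ k → u ≢ k →
                   minor M u j j k ≈P triangle (D u j) (D j k) (D u k)
  triangle-minor {u} {j} {k} u≢j j≢k u≢k i
    rewrite coeff--P (M u j *P M j k) (M u k *P M j j) i
          | M-off u≢j | M-off j≢k | M-off u≢k | M-diag j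
    = trans (cong₂ _-_ (*P-constˡ (+ D u j) (+ D j k ∷ []) i) (*P-constˡ (+ D u k) t i))
            (coeffs (+ D u j) (+ D j k) (+ D u k) i)
    where
    coeffs : ∀ a b c i → coeff (a ·P (b ∷ [])) i - coeff (c ·P t) i ≡ coeff (a * b ∷ - c ∷ []) i
    coeffs a b c zero          = constant a b c
      where
      constant : ∀ a b c → a * b - c * + 0 ≡ a * b
      constant = solve-∀
    coeffs a b c (suc zero)    = linear c
      where
      linear : ∀ c → + 0 - c * + 1 ≡ - c
      linear = solve-∀
    coeffs a b c (suc (suc i)) = refl

  digon-minor : ∀ {u w} → u ≢ w → minor M u w u w ≈P digon (D u w) (D w u)
  digon-minor {u} {w} u≢w i
    rewrite coeff--P (M u u *P M w w) (M u w *P M w u) i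
          | M-diag u | M-diag w | M-off u≢w | M-off (≢-sym u≢w)
    = trans (cong (_-_ (coeff (t *P t) i)) (*P-constˡ (+ D u w) (+ D w u ∷ []) i))
            (coeffs (+ D u w) (+ D w u) i)
    where
    coeffs : ∀ a b i →
             coeff (t *P t) i - coeff (a ·P (b ∷ [])) i ≡ coeff (- (a * b) ∷ + 0 ∷ + 1 ∷ []) i
    coeffs a b zero    = constant a b
      where
      constant : ∀ a b → + 0 - a * b ≡ - (a * b)
      constant = solve-∀
    coeffs a b (suc i) with i
    ... | zero        = refl
    ... | suc zero    = refl
    ... | suc (suc _) = refl

  triangle∈ : ∀ {u j k a b c} → D u j ≡ suc a → D j k ≡ suc b → D u k ≡ suc c →
              I (triangle (suc a) (suc b) (suc c))
  triangle∈ {u} {j} {k} {a} {b} {c} uj jk uk = subst I shape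
    (resp (triangle-minor u≢j j≢k (dist-suc⇒≢ uk)) (minor∈ M u≢j j≢k))
    where
    u≢j = dist-suc⇒≢ uj
    j≢k = dist-suc⇒≢ jk
    shape : triangle (D u j) (D j k) (D u k) ≡ triangle (suc a) (suc b) (suc c)
    shape rewrite uj | jk | uk = refl

  digon∈ : ∀ {u w a b} → D u w ≡ suc a → D w u ≡ suc b → I (digon (suc a) (suc b))
  digon∈ {u} {w} {a} {b} uw wu = subst I shape (resp (digon-minor u≢w) (minor∈ M u≢w u≢w))
    where
    u≢w = dist-suc⇒≢ uw
    shape : digon (D u w) (D w u) ≡ digon (suc a) (suc b)
    shape rewrite uw | wu = refl

  ev-M-diag : ∀ τ u → ev τ (M u u) ≡ τ
  ev-M-diag τ u rewrite M-diag u = ev-t τ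
    where
    ev-t : ∀ τ → + 0 + τ * (+ 1 + τ * + 0) ≡ τ
    ev-t = solve-∀

  ev-M-off : ∀ τ {u v k} → u ≢ v → D u v ≡ k → ev τ (M u v) ≡ + k
  ev-M-off τ {u} {v} u≢v refl rewrite M-off u≢v =
    trans (cong (_+_ (+ D u v)) (ℤ.*-zeroʳ τ)) (ℤ.+-identityʳ (+ D u v))

  dist≥3⇒1∈ : ∀ {u v k} → D u v ≡ 3 ℕ.+ k → I 1P
  -- −3(1 − 2t) + 2(2 − 3t) = 1
  dist≥3⇒1∈ {u} d with shortest-walk d
  ... | step {w = j} uj (step {w = k} jk (step {w = l} kl rest)) =
    lincomb∈ (- + 3 ∷ []) (+ 2 ∷ []) (triangle∈ d-uj d-jk d-uk) (triangle∈ d-uk d-kl d-ul)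
    where
    d-uj = arc⇒dist≡1 uj
    d-jk = arc⇒dist≡1 jk
    d-kl = arc⇒dist≡1 kl
    d-uk : D u k ≡ 2
    d-uk = dist-prefix (step uj (step jk here)) (step kl rest) d
    d-ul : D u l ≡ 3
    d-ul = dist-prefix (step uj (step jk (step kl here))) rest d

  module NonUnit (1∉I : ¬ I 1P) where

    dist≡1⊎2 : ∀ {u v} → u ≢ v → D u v ≡ 1 ⊎ D u v ≡ 2
    dist≡1⊎2 {u} {v} u≢v with D u v in d
    ... | 0                 = ⊥-elim (u≢v (dist≡0⇒≡ d))
    ... | 1                 = inj₁ refl
    ... | 2                 = inj₂ refl
    ... | suc (suc (suc _)) = ⊥-elim (1∉I (dist≥3⇒1∈ d))

    -- Modulo I, 3 ≡ 0 and t ≡ −1, so a path minor ab − ct ∈ I forces 3 ∣ ab + c.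
    module Digon {i j k v₀ w₀} (ij : D i j ≡ 1) (jk : D j k ≡ 1) (ik : D i k ≡ 2)
                 (v₀w₀ : D v₀ w₀ ≡ 1) (w₀v₀ : D w₀ v₀ ≡ 1) where

      -3∈ : I (- + 3 ∷ [])
      -3∈ = lincomb∈ (+ 1 ∷ + 2 ∷ []) (+ 4 ∷ []) (triangle∈ ij jk ik) (digon∈ v₀w₀ w₀v₀)

      1+t∈ : I (+ 1 ∷ + 1 ∷ [])
      1+t∈ = lincomb∈ (+ 1 ∷ []) (+ 0 ∷ - + 1 ∷ []) (triangle∈ ij jk ik) -3∈

      arc-symmetric : ∀ {u w} → D u w ≡ 1 → D w u ≡ 1
      arc-symmetric uw with dist≡1⊎2 (≢-sym (dist-suc⇒≢ uw))
      ... | inj₁ wu = wu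
      ... | inj₂ wu =
        ⊥-elim (1∉I (lincomb∈ (+ 1 ∷ []) (- + 1 ∷ []) (digon∈ v₀w₀ w₀v₀) (digon∈ uw wu)))

      no-triangle : ∀ {u j k} → D u j ≡ 1 → D j k ≡ 1 → D u k ≡ 1 → ⊥
      no-triangle uj jk uk = 1∉I (lincomb∈ (+ 2 ∷ []) (+ 1 ∷ []) 2∈ -3∈)
        where
        2∈ : I (+ 2 ∷ [])
        2∈ = lincomb∈ (+ 1 ∷ []) (+ 1 ∷ []) (triangle∈ uj jk uk) 1+t∈

      edge-dominating : ∀ {u j k} → D u j ≡ 1 → D j k ≡ 2 → D u k ≡ 2 → ⊥
      edge-dominating uj jk uk = 1∉I (lincomb∈ (+ 1 ∷ []) (+ 1 ∷ []) 4∈ -3∈)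
        where
        4∈ : I (+ 4 ∷ [])
        4∈ = lincomb∈ (+ 1 ∷ []) (+ 2 ∷ []) (triangle∈ uj jk uk) 1+t∈

      nonadjacency-transitive : ∀ {u j k} → D u j ≡ 2 → D j k ≡ 2 → D u k ≡ 1 → ⊥
      nonadjacency-transitive uj jk uk = 1∉I (lincomb∈ (+ 2 ∷ []) (+ 3 ∷ []) 5∈ -3∈)
        where
        5∈ : I (+ 5 ∷ [])
        5∈ = lincomb∈ (+ 1 ∷ []) (+ 1 ∷ []) (triangle∈ uj jk uk) 1+t∈

      non-neighbour : ∀ {u} → u ≢ v₀ → D v₀ u ≢ 1 → D v₀ u ≡ 2 × D u v₀ ≡ 2
      non-neighbour u≢v₀ ¬v₀u with dist≡1⊎2 (≢-sym u≢v₀) | dist≡1⊎2 u≢v₀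
      ... | inj₁ v₀u | _        = ⊥-elim (¬v₀u v₀u)
      ... | _        | inj₁ uv₀ = ⊥-elim (¬v₀u (arc-symmetric uv₀))
      ... | inj₂ v₀u | inj₂ uv₀ = v₀u , uv₀

      across : ∀ {u w} → u ≢ w → D v₀ u ≡ 1 → D v₀ w ≢ 1 → D u w ≡ 1
      across {u} {w} u≢w v₀u ¬v₀w with w ≟ᶠ v₀
      ... | yes refl = arc-symmetric v₀u
      ... | no w≢v₀  with dist≡1⊎2 u≢w
      ...   | inj₁ uw = uw
      ...   | inj₂ uw =
        ⊥-elim (edge-dominating (arc-symmetric v₀u) (proj₁ (non-neighbour w≢v₀ ¬v₀w)) uw)

      within : ∀ {u w} → D v₀ u ≢ 1 → D v₀ w ≢ 1 → D u w ≢ 1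
      within {u} {w} ¬v₀u ¬v₀w uw with u ≟ᶠ v₀ | w ≟ᶠ v₀
      ... | yes refl | _        = ¬v₀w uw
      ... | no _     | yes refl = ¬v₀u (arc-symmetric uw)
      ... | no u≢v₀  | no w≢v₀  =
        nonadjacency-transitive (proj₂ (non-neighbour u≢v₀ ¬v₀u))
                                (proj₁ (non-neighbour w≢v₀ ¬v₀w)) uw

      completeBipartite : IsCompleteBipartite G (G v₀)
      completeBipartite u w u≢w with G v₀ u in v₀u | G v₀ w in v₀w
      ... | true  | true  =
        dist≢1⇒¬arc (no-triangle (arc-symmetric (arc⇒dist≡1 v₀u)) (arc⇒dist≡1 v₀w))
      ... | true  | false =
        dist≡1⇒arc (across u≢w (arc⇒dist≡1 v₀u) (¬arc⇒dist≢1 v₀w))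
      ... | false | true  =
        dist≡1⇒arc (arc-symmetric (across (≢-sym u≢w) (arc⇒dist≡1 v₀w) (¬arc⇒dist≢1 v₀u)))
      ... | false | false =
        dist≢1⇒¬arc (within (¬arc⇒dist≢1 v₀u) (¬arc⇒dist≢1 v₀w))

      shape : Shape G
      shape = bipartite (G v₀) (v₀ , loopless v₀) (w₀ , dist≡1⇒arc v₀w₀) completeBipartite

    -- Modulo I, 7 ≡ 0 and 2t ≡ 1, so a path minor ab − ct ∈ I forces 7 ∣ 2ab − c.
    module Tournament (no-digon : ∀ {u w} → D u w ≡ 1 → D w u ≢ 1)
                      {a b c} (ab : D a b ≡ 1) (bc : D b c ≡ 1) (ac : D a c ≡ 2) where

      ba : D b a ≡ 2
      ba = [ ⊥-elim ∘ no-digon ab , id ]′ (dist≡1⊎2 (≢-sym (dist-suc⇒≢ ab)))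

      -7∈ : I (- + 7 ∷ [])
      -7∈ = lincomb∈ (+ 1 ∷ + 2 ∷ []) (+ 4 ∷ []) (triangle∈ ab bc ac) (digon∈ ab ba)

      onward : ∀ {u j k} → D u j ≡ 1 → k ≢ u → k ≢ j → D j k ≡ 1
      onward uj k≢u k≢j with dist≡1⊎2 (≢-sym k≢j)
      ... | inj₁ jk = jk
      ... | inj₂ jk with dist≡1⊎2 (≢-sym k≢u)
      ...   | inj₁ uk = ⊥-elim (1∉I (lincomb∈ (+ 5 ∷ []) (+ 2 ∷ []) 3∈ -7∈))
        where
        3∈ : I (+ 3 ∷ [])
        3∈ = lincomb∈ (+ 2 ∷ []) (- + 1 ∷ []) (triangle∈ uj jk uk) (triangle∈ ab bc ac)
      ...   | inj₂ uk =
        ⊥-elim (1∉I (lincomb∈ (+ 1 ∷ []) (- + 1 ∷ []) (triangle∈ uj jk uk) (triangle∈ ab bc ac)))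

      a≢b = dist-suc⇒≢ ab
      b≢c = dist-suc⇒≢ bc
      a≢c = dist-suc⇒≢ ac

      ca : D c a ≡ 1
      ca = onward bc a≢b a≢c

      cover : ∀ u → u ≡ a ⊎ u ≡ b ⊎ u ≡ c
      cover u with u ≟ᶠ a | u ≟ᶠ b | u ≟ᶠ c
      ... | yes u≡a | _       | _       = inj₁ u≡a
      ... | no _    | yes u≡b | _       = inj₂ (inj₁ u≡b)
      ... | no _    | no _    | yes u≡c = inj₂ (inj₂ u≡c)
      ... | no u≢a  | no u≢b  | no u≢c  = ⊥-elim (no-digon bu ub)
        where
        bu = onward ab u≢a u≢b
        cu = onward bc u≢b u≢c
        ub = onward cu b≢c (≢-sym u≢b)

      iso : Iso C3 G
      iso = Iso-C3 loopless cover (dist≡1⇒arc ab) (dist≡1⇒arc bc) (dist≡1⇒arc ca)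
        (dist≢1⇒¬arc (no-digon ab)) (dist≢1⇒¬arc (no-digon bc)) (dist≢1⇒¬arc (no-digon ca))

    classify : Shape G
    classify with any? (λ u → any? (λ v → D u v ℕ.≟ 2))
    ... | no ¬dist2 = complete λ u v u≢v →
      dist≡1⇒arc ([ id , (λ uv → ⊥-elim (¬dist2 (u , v , uv))) ]′ (dist≡1⊎2 u≢v))
    ... | yes (a , c , ac) with shortest-walk ac
    ...   | step ab (step bc here)
          with any? (λ u → any? (λ w → (D u w ℕ.≟ 1) ×-dec (D w u ℕ.≟ 1)))
    ...     | yes (v₀ , w₀ , v₀w₀ , w₀v₀) =
      Digon.shape (arc⇒dist≡1 ab) (arc⇒dist≡1 bc) ac v₀w₀ w₀v₀
    ...     | no ¬digon =
      cycle (Tournament.iso (λ uw wu → ¬digon (_ , _ , uw , wu)) (arc⇒dist≡1 ab) (arc⇒dist≡1 bc) ac)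

  rank-one-mod⇒¬unit : ∀ {L : Set} (κ : Fin n → L) (E : L → L → ℤ) (X Y : L → ℤ) τ m →
                       ¬ m ∣ + 1 → (∀ u v → ev τ (M u v) ≡ E (κ u) (κ v)) →
                       (∀ i j → m ∣ E i j - X i * Y j) → ¬ IsUnitIdeal (U₂gens D)
  rank-one-mod⇒¬unit κ E X Y τ m m∤1 entries table =
    ev-∣⇒¬unit τ m m∤1 (rank-one-mod⇒minor-∣ M τ m (X ∘ κ) (Y ∘ κ) congruent)
    where
    congruent : ∀ u v → m ∣ ev τ (M u v) - X (κ u) * Y (κ v)
    congruent u v = subst (λ e → m ∣ e - X (κ u) * Y (κ v)) (sym (entries u v)) (table (κ u) (κ v))

  complete⇒¬unit : IsComplete G → ¬ IsUnitIdeal (U₂gens D)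
  complete⇒¬unit G-complete = rank-one-mod⇒¬unit
    (λ _ → tt) (λ _ _ → + 1) (λ _ → + 1) (λ _ → + 1) (+ 1) (+ 2) (2+k∤1 0)
    entries (λ _ _ → divides (+ 0) refl)
    where
    entries : ∀ u v → ev (+ 1) (M u v) ≡ + 1
    entries u v with toSum (u ≟ᶠ v)
    ... | inj₁ refl = ev-M-diag (+ 1) u
    ... | inj₂ u≢v  = ev-M-off (+ 1) u≢v (arc⇒dist≡1 (G-complete u v u≢v))

  bipartite⇒¬unit : ∀ side → ∃ (λ u → side u ≡ false) → ∃ (λ v → side v ≡ true) →
                    IsCompleteBipartite G side → ¬ IsUnitIdeal (U₂gens D)
  bipartite⇒¬unit side (v₀ , s₀) (v₁ , s₁) bip =
    rank-one-mod⇒¬unit side E sign (-_ ∘ sign) (+ 2) (+ 3) (2+k∤1 1) entries table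
    where
    E : Bool → Bool → ℤ
    E i j = if i xor j then + 1 else + 2

    sign : Bool → ℤ
    sign false = + 1
    sign true  = - + 1

    table : ∀ i j → + 3 ∣ E i j - sign i * - sign j
    table false false = divides (+ 1) refl
    table false true  = divides (+ 0) refl
    table true  false = divides (+ 0) refl
    table true  true  = divides (+ 1) refl

    arc-across : ∀ {u w} b → side u ≡ b → side w ≡ not b → G u w ≡ true
    arc-across {u} {w} b su sw = trans (bip u w u≢w) (trans (cong₂ _xor_ su sw) (b-xor-not-b b))
      where
      u≢w : u ≢ w
      u≢w refl = not-¬ refl (trans (sym su) sw)
      b-xor-not-b : ∀ b → b xor not b ≡ true
      b-xor-not-b false = refl
      b-xor-not-b true  = refl

    entries : ∀ u v → ev (+ 2) (M u v) ≡ E (side u) (side v)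
    entries u v with toSum (u ≟ᶠ v)
    ... | inj₁ refl rewrite xor-same (side u) = ev-M-diag (+ 2) u
    ... | inj₂ u≢v with side u in su | side v in sv
    ...   | false | true  = ev-M-off (+ 2) u≢v (arc⇒dist≡1 (arc-across false su sv))
    ...   | true  | false = ev-M-off (+ 2) u≢v (arc⇒dist≡1 (arc-across true su sv))
    ...   | false | false = ev-M-off (+ 2) u≢v
            (dist≡2 u≢v (trans (bip u v u≢v) (cong₂ _xor_ su sv))
                    (arc-across false su s₁) (arc-across true s₁ sv))
    ...   | true  | true  = ev-M-off (+ 2) u≢v
            (dist≡2 u≢v (trans (bip u v u≢v) (cong₂ _xor_ su sv))
                    (arc-across true su s₀) (arc-across false s₀ sv))

  cycle⇒¬unit : Iso C3 G → ¬ IsUnitIdeal (U₂gens D)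
  cycle⇒¬unit (h , arcs) = rank-one-mod⇒¬unit from E X Y (+ 4) (+ 7) (2+k∤1 5) entries table
    where
    open Inverse h

    -- Modulo 7, E x y ≡ 2 ^ (2 + y − x) = 4 ^ x · 2 ^ (2 + y).
    E : Fin 3 → Fin 3 → ℤ
    E 0F 0F = + 4
    E 0F 1F = + 1
    E 0F 2F = + 2
    E 1F 0F = + 2
    E 1F 1F = + 4
    E 1F 2F = + 1
    E 2F 0F = + 1
    E 2F 1F = + 2
    E 2F 2F = + 4

    X Y : Fin 3 → ℤ
    X 0F = + 1
    X 1F = + 4
    X 2F = + 2
    Y 0F = + 4
    Y 1F = + 1
    Y 2F = + 2

    table : ∀ i j → + 7 ∣ E i j - X i * Y j
    table 0F 0F = divides (+ 0) refl
    table 0F 1F = divides (+ 0) refl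
    table 0F 2F = divides (+ 0) refl
    table 1F 0F = divides (- + 2) refl
    table 1F 1F = divides (+ 0) refl
    table 1F 2F = divides (- + 1) refl
    table 2F 0F = divides (- + 1) refl
    table 2F 1F = divides (+ 0) refl
    table 2F 2F = divides (+ 0) refl

    arc-entry : ∀ {x y} → C3 x y ≡ true → ev (+ 4) (M (to x) (to y)) ≡ + 1
    arc-entry {x} {y} xy = ev-M-off (+ 4) (arc⇒≢ {G = G} loopless G-xy) (arc⇒dist≡1 G-xy)
      where
      G-xy = trans (sym (arcs x y)) xy

    two-step-entry : ∀ {x y} z → x ≢ y → C3 x y ≡ false → C3 x z ≡ true → C3 z y ≡ true →
                     ev (+ 4) (M (to x) (to y)) ≡ + 2
    two-step-entry {x} {y} z x≢y ¬xy xz zy = ev-M-off (+ 4) (↔-≢ h x≢y)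
      (dist≡2 (↔-≢ h x≢y) (trans (sym (arcs x y)) ¬xy)
              (trans (sym (arcs x z)) xz) (trans (sym (arcs z y)) zy))

    on-image : ∀ x y → ev (+ 4) (M (to x) (to y)) ≡ E x y
    on-image 0F 0F = ev-M-diag (+ 4) (to 0F)
    on-image 0F 1F = arc-entry refl
    on-image 0F 2F = two-step-entry 1F (λ ()) refl refl refl
    on-image 1F 0F = two-step-entry 2F (λ ()) refl refl refl
    on-image 1F 1F = ev-M-diag (+ 4) (to 1F)
    on-image 1F 2F = arc-entry refl
    on-image 2F 0F = arc-entry refl
    on-image 2F 1F = two-step-entry 0F (λ ()) refl refl refl
    on-image 2F 2F = ev-M-diag (+ 4) (to 2F)

    entries : ∀ u v → ev (+ 4) (M u v) ≡ E (from u) (from v)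
    entries u v = subst₂ (λ u′ v′ → ev (+ 4) (M u′ v′) ≡ E (from u) (from v))
                         (strictlyInverseˡ u) (strictlyInverseˡ v) (on-image (from u) (from v))

  Shape⇒¬unit : Shape G → ¬ IsUnitIdeal (U₂gens D)
  Shape⇒¬unit (complete c)              = complete⇒¬unit c
  Shape⇒¬unit (bipartite side s₀ s₁ b)  = bipartite⇒¬unit side s₀ s₁ b
  Shape⇒¬unit (cycle iso)               = cycle⇒¬unit iso

corollary14 : ∀ {n} (G : Digraph n) → 1 ≤ n → Loopless G → StronglyConnected G →
    (D : Fin n → Fin n → ℕ) → IsDistanceMatrix G D →
    (¬ IsUnitIdeal (U₂gens D)) ⇔
      (Iso G C3 ⊎
        Σ ℕ λ a → Σ ℕ λ b → Σ ℕ λ c → Σ ℕ λ d →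
          StronglyConnected (Λ a b c d) × Iso G (Λ a b c d) ×
          ((a ≢ 0 × b ≡ 0 × c ≡ 0 × d ≡ 0)
           ⊎ (c ≢ 0 × a ≡ 0 × b ≡ 0 × d ≡ 0)
           ⊎ (b ≥ 1 × d ≥ 1 × a ≡ 0 × c ≡ 0)))
corollary14 G 1≤n loopless sc D isDist =
  mk⇔ (Shape⇒C3-or-Λ 1≤n loopless sc ∘ NonUnit.classify ∘ (_∘ 1∈⇒unit))
      (Shape⇒¬unit ∘ C3-or-Λ⇒Shape)
  where open Distance loopless isDist
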